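{- Let $k \in \mathbb{N}$, let $v_1, \ldots, v_s \in \Sigma^+$, let $V = ([v_1], \ldots, [v_s])$ (the concatenation of the ordered conjugacy classes, a list of length $n = \sum_i |v_i|$), let $c_i = \mathrm{context}_k(v_i)$ for $1 \le i \le s$, and let $G = G_k(M_k(V))$. Let $\mathcal{C}_1$ be the set of all edges of $G$. Then there are edge sets $\mathcal{C}_2, \ldots, \mathcal{C}_{s+1}$ such that for every $i \in \{1, \ldots, s\}$, $$(\mathcal{C}_i, c_i) \xrightarrow{\;v_i\;} (\mathcal{C}_{i+1}, c_i).$$
   Context: $\Sigma$ is a finite non-empty alphabet with a linear order $\leq$; $\Sigma^+$ is the set of non-empty words; words are compared lexicographically. For $w = a_1 \cdots a_n$: $\mathrm{last}(w) = a_n$; $r(w) = a_n a_1 \cdots a_{n-1}$ is the right-shift with iterates $r^i$; the ordered conjugacy class is the list $[w] = (r^0(w), r^1(w), \ldots, r^{n-1}(w))$; $\mathrm{context}_k(w)$ is the prefix of length $k$ of the infinite word $w^\omega = www\cdots$. For a list $V = (x_1, \ldots, x_n)$ of non-empty words, the $k$-order standard permutation $\nu_{k,V}$ is defined by ordering indices via $i \preceq j$ iff $\mathrm{context}_k(x_i) < \mathrm{context}_k(x_j)$, or $\mathrm{context}_k(x_i) = \mathrm{context}_k(x_j)$ and $i \leq j$; if $j_1 \prec \cdots \prec j_n$ is the resulting enumeration then $\nu_{k,V}(i) = j_i$; and $M_k(V) = (x_{\nu_{k,V}(1)}, \ldots, x_{\nu_{k,V}(n)})$. For a list $M = (w_1,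 \ldots, w_n)$ of non-empty words, the $k$-order context graph $G_k(M)$ is the edge-labeled directed graph whose vertices are the words $\mathrm{context}_k(w_i)$, $1\le i\le n$, and which has, for each $i \in \{1,\ldots,n\}$, one edge $(c, i, c')$ with $c = \mathrm{context}_k(w_i)$ and $c' = \mathrm{context}_k(r(w_i))$. A configuration is a pair $(\mathcal{C}, c)$ of a set $\mathcal{C}$ of edges and a vertex $c$. Single-step transition: if $\mathcal{C}$ contains an edge starting at $c$ and $(c, i, c')$ is the one among them with the smallest label $i$, then $(\mathcal{C}, c) \xrightarrow{a} (\mathcal{C} \setminus \{(c,i,c')\}, c')$ with $a = \mathrm{last}(w_i)$; otherwise no transition from $(\mathcal{C},c)$ is defined. Multi-step transitions: $(\mathcal{C}, c) \xrightarrow{\varepsilon} (\mathcal{C}, c)$, and for $a \in \Sigma$, $u \in \Sigma^*$, $(\mathcal{C}_1, c_1) \xrightarrow{au} (\mathcal{C}_2, c_2)$ iff there is a configuration $(\mathcal{C}', c')$ with $(\mathcal{C}_1, c_1) \xrightarrow{u} (\mathcal{C}', c')$ and $(\mathcal{C}', c') \xrightarrow{a} (\mathcal{C}_2, c_2)$ (so the word $u$ is read from right to left along the path). -}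

module Defs where

open import Level using (0ℓ)
open import Data.Bool using (Bool; true; false; if_then_else_)
open import Data.Nat using (ℕ; zero; suc; _≤_; _≤?_)
open import Data.Fin using (Fin)
open import Data.Product using (Σ; ∃; _×_; _,_; proj₁; proj₂)
open import Data.Sum using (_⊎_)
open import Data.Maybe using (Maybe; just; nothing)
open import Data.List using (List; []; _∷_; take; concat; replicate; map; length; upTo; foldl; zip)
open import Data.List.NonEmpty using (List⁺; _∷_; toList; last)
import Data.List.NonEmpty as L⁺
open import Data.List.Relation.Binary.Lex.Strict using (Lex-<; <-decidable)
import Data.List.Properties as LP
open import Relation.Nullary using (Dec; yes; no; does; ¬_)
open import Relation.Binary using (Rel; IsStrictTotalOrder)
open import Relation.Binary.PropositionalEquality using (_≡_)
open import Function.Bundles using (_↔_)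

FiniteNonEmpty : Set → Set
FiniteNonEmpty A = Σ ℕ λ m → A ↔ Fin (suc m)

module Words {A : Set} {_<_ : Rel A 0ℓ}
             (sto : IsStrictTotalOrder _≡_ _<_) where

  open IsStrictTotalOrder sto using (_≟_; _<?_)

  Word : Set
  Word = List⁺ A

  initL : A → List A → List A
  initL x []       = []
  initL x (y ∷ ys) = x ∷ initL y ys

  r : Word → Word
  r (x ∷ xs) = last (x ∷ xs) ∷ initL x xs

  r^ : ℕ → Word → Word
  r^ zero    w = w
  r^ (suc i) w = r (r^ i w)

  conjClass : Word → List Word
  conjClass w = map (λ i → r^ i w) (upTo (L⁺.length w))

  -- context_k(w): prefix of length k of w^ω
  -- (k copies of w already have length ≥ k since |w| ≥ 1)
  context : ℕ → Word → List A
  context k w = take k (concat (replicate k (toList w)))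

  _<ₗ_ : Rel (List A) 0ℓ
  _<ₗ_ = Lex-< _≡_ _<_

  _<ₗ?_ : (x y : List A) → Dec (x <ₗ y)
  _<ₗ?_ = <-decidable _≟_ _<?_

  _≟ₗ_ : (x y : List A) → Dec (x ≡ y)
  _≟ₗ_ = LP.≡-dec _≟_

  -- Indices are 1-based.  i ⪯ j iff context_k(x_i) < context_k(x_j),
  -- or the contexts are equal and i ≤ j.

  Indexed : Set
  Indexed = ℕ × Word

  _⪯?_ : ℕ → Indexed → Indexed → Bool
  (k ⪯? (i , x)) (j , y) with context k x <ₗ? context k y
  ... | yes _ = true
  ... | no _ with context k x ≟ₗ context k y
  ...   | yes _ = does (i ≤? j)
  ...   | no _  = false

  insert : ℕ → Indexed → List Indexed → List Indexed
  insert k e []       = e ∷ []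
  insert k e (f ∷ fs) = if (k ⪯? e) f then e ∷ f ∷ fs else f ∷ insert k e fs

  sortIdx : ℕ → List Indexed → List Indexed
  sortIdx k = foldl (λ acc e → insert k e acc) []

  indexed : List Word → List Indexed
  indexed V = zip (map suc (upTo (length V))) V

  ν : ℕ → List Word → List ℕ
  ν k V = map proj₁ (sortIdx k (indexed V))

  M : ℕ → List Word → List Word
  M k V = map proj₂ (sortIdx k (indexed V))

  Vertex : Set
  Vertex = List A

  Edge : Set
  Edge = Vertex × ℕ × Vertex

  EdgeSet : Set₁
  EdgeSet = Edge → Set

  -- 1-based lookup in a list
  at : List Word → ℕ → Maybe Word
  at []       _             = nothing
  at (x ∷ xs) zero          = nothing
  at (x ∷ xs) (suc zero)    = just x
  at (x ∷ xs) (suc (suc i)) = at xs (suc i)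

  edgesG : ℕ → List Word → EdgeSet
  edgesG k Ms (c , i , c') =
    Σ Word λ w → (at Ms i ≡ just w) × (c ≡ context k w) × (c' ≡ context k (r w))

  _≐_ : EdgeSet → EdgeSet → Set
  C ≐ D = ∀ e → (C e → D e) × (D e → C e)

  _∖_ : EdgeSet → Edge → EdgeSet
  (C ∖ e) e' = C e' × ¬ (e' ≡ e)

  Step : List Word → EdgeSet → Vertex → A → EdgeSet → Vertex → Set
  Step Ms C c a C' c' =
    Σ ℕ λ i →
      C (c , i , c')
    × (∀ j d → C (c , j , d) → i ≤ j)
    × (C' ≐ (C ∖ (c , i , c')))
    × Σ Word (λ w → (at Ms i ≡ just w) × (a ≡ last w))

  -- multi-step transitions; the word is read from right to left:
  -- (C₁,c₁) --au--> (C₂,c₂) iff (C₁,c₁) --u--> (C',c') --a--> (C₂,c₂)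
  data Steps (Ms : List Word) : EdgeSet → Vertex → List A → EdgeSet → Vertex → Set₁ where
    ε    : ∀ {C c} → Steps Ms C c [] C c
    step : ∀ {C₁ c₁ C' c' C₂ c₂ a u} →
           Steps Ms C₁ c₁ u C' c' → Step Ms C' c' a C₂ c₂ →
           Steps Ms C₁ c₁ (a ∷ u) C₂ c₂

-- The sort defining M_k(V) is stable: entries of V with equal k-contexts keep
-- their relative order. So once the edges of the first p entries of V have been
-- removed, the remaining edge with the smallest label leaving context_k(y), where
-- y is the (p+1)-st entry of V, is the edge of y itself; it reads last(y) and
-- leads to context_k(r y). The entries of [v_i] are v_i, r(v_i), r²(v_i), …, so
-- starting from c_i the walk removes exactly the edges of [v_i], reads the letters
-- of v_i from last to first, and returns to c_i because r^{|v_i|}(v_i) = v_i.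

module Submission where

open import Defs
open import Level using (0ℓ)
open import Data.Nat using (ℕ; suc)
open import Data.Fin using (Fin; zero; suc; inject₁)
open import Data.Vec using (Vec; lookup; toList)
open import Data.List using (List; concat; map)
import Data.List.NonEmpty as L⁺
open import Data.Product using (Σ; _×_)
open import Relation.Binary using (Rel; IsStrictTotalOrder)
open import Relation.Binary.PropositionalEquality using (_≡_)

open import Data.Nat.Properties as NP
  using (≤-refl; <-irrefl; <-trans; <-cmp; <⇒≱; ≮⇒≥; ≰⇒>; n<1+n; m<n⇒m<1+n; m≤n⇒m<n∨m≡n; +-identityʳ; ≤ᵇ⇒≤; ≤⇒≤ᵇ)

open import Algebra.Properties.CommutativeSemigroup NP.+-commutativeSemigroup using (x∙yz≈y∙xz)
open import Data.Bool using (true; false; T)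
open import Data.List using ([]; _∷_; _++_; _∷ʳ_; [_]; length; applyUpTo; zip; foldl; initLast; _∷ʳ′_)
open import Data.List.Membership.Propositional using (_∈_)
open import Data.List.NonEmpty using (_∷_)
open import Data.List.Properties using (++-assoc; ++-identityʳ; ∷ʳ-injective; length-applyUpTo; map-applyUpTo)
open import Data.List.Relation.Binary.Lex.Strict using (<-isStrictTotalOrder)
open import Data.List.Relation.Binary.Permutation.Propositional using (_↭_; ↭-refl; ↭-sym; ↭-trans; ↭-reflexive; prep; swap)
open import Data.List.Relation.Binary.Permutation.Propositional.Properties using (All-resp-↭; ∈-resp-↭; ++⁺ˡ; shift)
open import Data.List.Relation.Binary.Pointwise using (Pointwise-≡⇒≡)
open import Data.List.Relation.Unary.All as All using (All; []; _∷_)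
open import Data.List.Relation.Unary.AllPairs using (AllPairs; []; _∷_)
open import Data.List.Relation.Unary.Any using (here; there)
open import Data.Maybe using (Maybe; just; nothing)
open import Data.Maybe.Properties using (just-injective)
open import Data.Nat using (zero; _+_; _<_; _≤_; z≤n; s≤s)
open import Data.Product using (_,_; proj₁; proj₂; ∃-syntax)
open import Data.Product.Relation.Binary.Lex.Strict using (×-Lex; ×-transitive)
open import Data.Sum using (inj₁; inj₂)
open import Data.Unit using (tt)
open import Data.Vec using (_∷_)
open import Function using (_∘_; _on_; case_of_)
open import Relation.Binary using (tri<; tri≈; tri>)
open import Relation.Binary.PropositionalEquality using (_≢_; refl; sym; trans; cong; cong₂; subst; isEquivalence; resp₂; module ≡-Reasoning)
open import Relation.Nullary using (¬_; yes; no; contradiction)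

open ≡-Reasoning

module _ {X : Set} where

  lookup₁ : List X → ℕ → Maybe X
  lookup₁ _        zero          = nothing
  lookup₁ []       (suc _)       = nothing
  lookup₁ (x ∷ _)  (suc zero)    = just x
  lookup₁ (_ ∷ xs) (suc (suc i)) = lookup₁ xs (suc i)

  lookup₁⇒∈ : ∀ {xs} ℓ {x} → lookup₁ xs ℓ ≡ just x → x ∈ xs
  lookup₁⇒∈ {_ ∷ _}  (suc zero)    refl = here refl
  lookup₁⇒∈ {_ ∷ xs} (suc (suc ℓ)) eq   = there (lookup₁⇒∈ (suc ℓ) eq)

  ∈⇒lookup₁ : ∀ {xs x} → x ∈ xs → ∃[ ℓ ] lookup₁ xs ℓ ≡ just x
  ∈⇒lookup₁ (here refl) = 1 , refl
  ∈⇒lookup₁ (there m) with ∈⇒lookup₁ m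
  ... | suc ℓ , eq = suc (suc ℓ) , eq

  lookup₁-++ : ∀ xs ys q → lookup₁ (xs ++ ys) (suc (length xs + q)) ≡ lookup₁ ys (suc q)
  lookup₁-++ []       ys q = refl
  lookup₁-++ (x ∷ xs) ys q = lookup₁-++ xs ys q

  lookup₁-applyUpTo-++ : ∀ (f : ℕ → X) n ys {j} → j < n →
                         lookup₁ (applyUpTo f n ++ ys) (suc j) ≡ just (f j)
  lookup₁-applyUpTo-++ f (suc n) ys {zero}  _         = refl
  lookup₁-applyUpTo-++ f (suc n) ys {suc j} (s≤s j<n) = lookup₁-applyUpTo-++ (f ∘ suc) n ys j<n

  AllPairs-lookup₁ : ∀ {R : Rel X 0ℓ} {xs a b x y} → AllPairs R xs → a < b →
                     lookup₁ xs a ≡ just x → lookup₁ xs b ≡ just y → R x y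
  AllPairs-lookup₁ {xs = _ ∷ _} {suc zero} {suc (suc b)} (px ∷ _) _ refl eq =
    All.lookup px (lookup₁⇒∈ (suc b) eq)
  AllPairs-lookup₁ {xs = _ ∷ _} {suc zero} {suc zero} _ (s≤s ()) _ _
  AllPairs-lookup₁ {xs = _ ∷ _} {suc (suc a)} {suc (suc b)} (_ ∷ pxs) (s≤s a<b) eqa eqb =
    AllPairs-lookup₁ {a = suc a} {suc b} pxs a<b eqa eqb

  lookup₁-injective : ∀ {R : Rel X 0ℓ} {xs a b x} → (∀ {y} → ¬ R y y) → AllPairs R xs →
                      lookup₁ xs a ≡ just x → lookup₁ xs b ≡ just x → a ≡ b
  lookup₁-injective {a = a} {b} irr sorted eqa eqb with <-cmp a b
  ... | tri< a<b _ _ = contradiction (AllPairs-lookup₁ sorted a<b eqa eqb) irr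
  ... | tri≈ _ a≡b _ = a≡b
  ... | tri> _ _ b<a = contradiction (AllPairs-lookup₁ sorted b<a eqb eqa) irr

  ∈-zip-applyUpTo⁺ : ∀ (f : ℕ → ℕ) xs j {x} → lookup₁ xs (suc j) ≡ just x →
                     (f j , x) ∈ zip (applyUpTo f (length xs)) xs
  ∈-zip-applyUpTo⁺ f (_ ∷ _)  zero    refl = here refl
  ∈-zip-applyUpTo⁺ f (_ ∷ xs) (suc j) eq   = there (∈-zip-applyUpTo⁺ (f ∘ suc) xs j eq)

  ∈-zip-applyUpTo⁻ : ∀ (f : ℕ → ℕ) xs {i x} → (i , x) ∈ zip (applyUpTo f (length xs)) xs →
                     ∃[ j ] i ≡ f j × lookup₁ xs (suc j) ≡ just x
  ∈-zip-applyUpTo⁻ f (_ ∷ _)  (here refl) = 0 , refl , refl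
  ∈-zip-applyUpTo⁻ f (_ ∷ xs) (there m) with ∈-zip-applyUpTo⁻ (f ∘ suc) xs m
  ... | j , i≡ , eq = suc j , i≡ , eq

  zip-applyUpTo-increasing : ∀ (f : ℕ → ℕ) xs → (∀ {i j} → i < j → f i < f j) →
                             AllPairs (_<_ on proj₁) (zip (applyUpTo f (length xs)) xs)
  zip-applyUpTo-increasing f []       _    = []
  zip-applyUpTo-increasing f (_ ∷ xs) mono =
    All.tabulate (λ m → case ∈-zip-applyUpTo⁻ (f ∘ suc) xs m of λ where
                          (_ , refl , _) → mono (s≤s z≤n))
    ∷ zip-applyUpTo-increasing (f ∘ suc) xs (mono ∘ s≤s)

module WordsProperties {A : Set} {_⊏_ : Rel A 0ℓ} (sto : IsStrictTotalOrder _≡_ _⊏_) where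

  open Words sto

  initL-∷ʳ : ∀ x ys y → initL x (ys ∷ʳ y) ≡ x ∷ ys
  initL-∷ʳ x []       y = refl
  initL-∷ʳ x (z ∷ zs) y = cong (x ∷_) (initL-∷ʳ z zs y)

  ∷-initL-last : ∀ x xs → x ∷ xs ≡ initL x xs ∷ʳ L⁺.last (x ∷ xs)
  ∷-initL-last x xs with initLast xs
  ... | []       = refl
  ... | ys ∷ʳ′ y = cong (_∷ʳ y) (sym (initL-∷ʳ x ys y))

  r-∷ʳ : ∀ w {ys a} → L⁺.toList w ≡ ys ∷ʳ a → L⁺.toList (r w) ≡ a ∷ ys × L⁺.last w ≡ a
  r-∷ʳ (x ∷ xs) {ys} eq with ∷ʳ-injective (initL x xs) ys (trans (sym (∷-initL-last x xs)) eq)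
  ... | init≡ , last≡ = cong₂ _∷_ last≡ init≡ , last≡

  r^-++ : ∀ x ys zs → L⁺.toList x ≡ ys ++ zs → L⁺.toList (r^ (length zs) x) ≡ zs ++ ys
  r^-∷ʳ : ∀ x ys a zs → L⁺.toList x ≡ ys ++ a ∷ zs →
          L⁺.toList (r^ (length zs) x) ≡ (zs ++ ys) ∷ʳ a

  r^-++ x ys []       eq = trans eq (++-identityʳ ys)
  r^-++ x ys (a ∷ zs) eq = proj₁ (r-∷ʳ (r^ (length zs) x) (r^-∷ʳ x ys a zs eq))

  r^-∷ʳ x ys a zs eq = begin
    L⁺.toList (r^ (length zs) x) ≡⟨ r^-++ x (ys ∷ʳ a) zs (trans eq (sym (++-assoc ys [ a ] zs))) ⟩
    zs ++ ys ∷ʳ a                ≡⟨ sym (++-assoc zs ys [ a ]) ⟩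
    (zs ++ ys) ∷ʳ a              ∎

  last-r^ : ∀ x ys a zs → L⁺.toList x ≡ ys ++ a ∷ zs → L⁺.last (r^ (length zs) x) ≡ a
  last-r^ x ys a zs eq = proj₂ (r-∷ʳ (r^ (length zs) x) (r^-∷ʳ x ys a zs eq))

  toList-injective : ∀ {x y : Word} → L⁺.toList x ≡ L⁺.toList y → x ≡ y
  toList-injective {_ ∷ _} {_ ∷ _} refl = refl

  r^-length : ∀ x → r^ (L⁺.length x) x ≡ x
  r^-length x = toList-injective (trans (r^-++ x [] (L⁺.toList x) refl) (++-identityʳ (L⁺.toList x)))

  Step-resp-≐ˡ : ∀ {Ms C C′ c a E c′} → C ≐ C′ → Step Ms C′ c a E c′ → Step Ms C c a E c′
  Step-resp-≐ˡ {C = C} {c = c} {E = E} {c′} C≐C′ (i , mem , minimal , E≐ , word) =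
    i , proj₂ (C≐C′ _) mem , (λ j d m → minimal j d (proj₁ (C≐C′ _) m)) , E≐C∖ , word
    where
    E≐C∖ : E ≐ (C ∖ (c , i , c′))
    E≐C∖ e = (λ m → case proj₁ (E≐ e) m of λ where (m′ , ne) → proj₂ (C≐C′ e) m′ , ne)
          , (λ where (m′ , ne) → proj₂ (E≐ e) (proj₁ (C≐C′ e) m′ , ne))

  Steps-resp-≐ˡ : ∀ {Ms C C′ c a u E c′} → C ≐ C′ →
                  Steps Ms C′ c (a ∷ u) E c′ → Steps Ms C c (a ∷ u) E c′
  Steps-resp-≐ˡ {Ms} C≐C′ (step ε st)            = step ε (Step-resp-≐ˡ {Ms} C≐C′ st)
  Steps-resp-≐ˡ      C≐C′ (step s@(step _ _) st) = step (Steps-resp-≐ˡ C≐C′ s) st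

  module LexOrder = IsStrictTotalOrder (<-isStrictTotalOrder sto)

  <ₗ-irrefl : ∀ {xs} → ¬ (xs <ₗ xs)
  <ₗ-irrefl = LexOrder.irrefl LexOrder.Eq.refl

  module Sorting (k : ℕ) where

    _≺_ : Rel Indexed 0ℓ
    _≺_ = ×-Lex _≡_ _<ₗ_ _<_ on λ e → context k (proj₂ e) , proj₁ e

    ≺-trans : ∀ {e f g} → e ≺ f → f ≺ g → e ≺ g
    ≺-trans = ×-transitive {_<₁_ = _<ₗ_} {_<₂_ = _<_} isEquivalence (resp₂ _<ₗ_) LexOrder.trans <-trans

    ≺-irrefl : ∀ {e} → ¬ (e ≺ e)
    ≺-irrefl (inj₁ lt)       = <ₗ-irrefl lt
    ≺-irrefl (inj₂ (_ , lt)) = <-irrefl refl lt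

    ≺-stable : ∀ {e f} → e ≺ f → context k (proj₂ e) ≡ context k (proj₂ f) → proj₁ e < proj₁ f
    ≺-stable (inj₁ lt)       same = contradiction (subst (_<ₗ _) same lt) <ₗ-irrefl
    ≺-stable (inj₂ (_ , lt)) _    = lt

    ⪯?-true : ∀ {e f} → proj₁ f < proj₁ e → (k ⪯? e) f ≡ true → e ≺ f
    ⪯?-true {i , x} {j , y} j<i eq with context k x <ₗ? context k y
    ... | yes x<y = inj₁ x<y
    ... | no _ with context k x ≟ₗ context k y
    ...   | no _  = contradiction eq λ ()
    ...   | yes _ = contradiction (≤ᵇ⇒≤ i j (subst T (sym eq) tt)) (<⇒≱ j<i)

    ⪯?-false : ∀ {e f} → (k ⪯? e) f ≡ false → f ≺ e
    ⪯?-false {i , x} {j , y} eq with context k x <ₗ? context k y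
    ... | yes _ = contradiction eq λ ()
    ... | no x≮y with context k x ≟ₗ context k y
    ...   | yes x≡y = inj₂ (sym x≡y , ≰⇒> (λ i≤j → subst T eq (≤⇒≤ᵇ i≤j)))
    ...   | no x≢y with LexOrder.compare (context k x) (context k y)
    ...     | tri< x<y _ _ = contradiction x<y x≮y
    ...     | tri≈ _ x≈y _ = contradiction (Pointwise-≡⇒≡ x≈y) x≢y
    ...     | tri> _ _ y<x = inj₁ y<x

    insert-↭ : ∀ e fs → insert k e fs ↭ e ∷ fs
    insert-↭ e []       = ↭-refl
    insert-↭ e (f ∷ fs) with (k ⪯? e) f
    ... | true  = ↭-refl
    ... | false = ↭-trans (prep f (insert-↭ e fs)) (swap f e ↭-refl)

    insert-sorted : ∀ e fs → All (λ f → proj₁ f < proj₁ e) fs →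
                    AllPairs _≺_ fs → AllPairs _≺_ (insert k e fs)
    insert-sorted e []       []         []         = [] ∷ []
    insert-sorted e (f ∷ fs) (f<e ∷ fs<e) (f≺fs ∷ sorted) with (k ⪯? e) f in eq
    ... | true  = (e≺f ∷ All.map (≺-trans e≺f) f≺fs) ∷ f≺fs ∷ sorted
      where
      e≺f : e ≺ f
      e≺f = ⪯?-true f<e eq
    ... | false = All-resp-↭ (↭-sym (insert-↭ e fs)) (⪯?-false eq ∷ f≺fs) ∷ insert-sorted e fs fs<e sorted

    insertAll : List Indexed → List Indexed → List Indexed
    insertAll = foldl (λ acc e → insert k e acc)

    insertAll-↭ : ∀ acc es → insertAll acc es ↭ es ++ acc
    insertAll-↭ acc []       = ↭-refl
    insertAll-↭ acc (e ∷ es) =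
      ↭-trans (insertAll-↭ (insert k e acc) es) (↭-trans (++⁺ˡ es (insert-↭ e acc)) (shift e es acc))

    insertAll-sorted : ∀ acc es → AllPairs _≺_ acc → AllPairs (_<_ on proj₁) es →
                       All (λ a → All (λ e → proj₁ a < proj₁ e) es) acc → AllPairs _≺_ (insertAll acc es)
    insertAll-sorted acc []       sorted _              _     = sorted
    insertAll-sorted acc (e ∷ es) sorted (e<es ∷ inc) acc<es =
      insertAll-sorted (insert k e acc) es (insert-sorted e acc (All.map All.head acc<es) sorted) inc
        (All-resp-↭ (↭-sym (insert-↭ e acc)) (e<es ∷ All.map All.tail acc<es))

    sortIdx-↭ : ∀ es → sortIdx k es ↭ es
    sortIdx-↭ es = ↭-trans (insertAll-↭ [] es) (↭-reflexive (++-identityʳ es))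

    sortIdx-sorted : ∀ es → AllPairs (_<_ on proj₁) es → AllPairs _≺_ (sortIdx k es)
    sortIdx-sorted es inc = insertAll-sorted [] es [] inc []

  indexed-zip : ∀ V → indexed V ≡ zip (applyUpTo suc (length V)) V
  indexed-zip V = cong (λ is → zip is V) (map-applyUpTo (λ i → i) suc (length V))

  at-map-proj₂⁺ : ∀ {X : Set} (xs : List (X × Word)) ℓ {q w} →
                  lookup₁ xs ℓ ≡ just (q , w) → at (map proj₂ xs) ℓ ≡ just w
  at-map-proj₂⁺ (_ ∷ _)  (suc zero)    refl = refl
  at-map-proj₂⁺ (_ ∷ xs) (suc (suc ℓ)) eq   = at-map-proj₂⁺ xs (suc ℓ) eq

  at-map-proj₂⁻ : ∀ {X : Set} (xs : List (X × Word)) ℓ {w} →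
                  at (map proj₂ xs) ℓ ≡ just w → ∃[ q ] lookup₁ xs ℓ ≡ just (q , w)
  at-map-proj₂⁻ ((q , _) ∷ _) (suc zero)    refl = q , refl
  at-map-proj₂⁻ (_ ∷ xs)      (suc (suc ℓ)) eq   = at-map-proj₂⁻ xs (suc ℓ) eq

  module ContextGraph (k : ℕ) (V : List Word) where

    open Sorting k

    G : List Word
    G = M k V

    L : List Indexed
    L = sortIdx k (indexed V)

    L-sorted : AllPairs _≺_ L
    L-sorted = sortIdx-sorted (indexed V)
      (subst (AllPairs (_<_ on proj₁)) (sym (indexed-zip V)) (zip-applyUpTo-increasing suc V s≤s))

    L↭indices : L ↭ zip (applyUpTo suc (length V)) V
    L↭indices = ↭-trans (sortIdx-↭ (indexed V)) (↭-reflexive (indexed-zip V))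

    ∈L⇒lookup₁ : ∀ {i x} → (i , x) ∈ L → lookup₁ V i ≡ just x
    ∈L⇒lookup₁ {x = x} m with ∈-zip-applyUpTo⁻ suc V (∈-resp-↭ L↭indices m)
    ... | _ , i≡ , eq = subst (λ n → lookup₁ V n ≡ just x) (sym i≡) eq

    lookup₁⇒∈L : ∀ {j x} → lookup₁ V (suc j) ≡ just x → (suc j , x) ∈ L
    lookup₁⇒∈L eq = ∈-resp-↭ (↭-sym L↭indices) (∈-zip-applyUpTo⁺ suc V _ eq)

    ∈L⇒positive : ∀ {i x} → (i , x) ∈ L → 0 < i
    ∈L⇒positive {zero}  m = case ∈L⇒lookup₁ m of λ ()
    ∈L⇒positive {suc i} _ = s≤s z≤n

    Remaining : ℕ → EdgeSet
    Remaining p (c , ℓ , c′) =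
      Σ ℕ λ q → Σ Word λ w →
        lookup₁ L ℓ ≡ just (q , w) × p < q × c ≡ context k w × c′ ≡ context k (r w)

    edgesG≐Remaining₀ : edgesG k G ≐ Remaining 0
    edgesG≐Remaining₀ (c , ℓ , c′) = to , from
      where
      to : edgesG k G (c , ℓ , c′) → Remaining 0 (c , ℓ , c′)
      to (w , atℓ , ce , ce′) with at-map-proj₂⁻ L ℓ atℓ
      ... | q , eq = q , w , eq , ∈L⇒positive (lookup₁⇒∈ ℓ eq) , ce , ce′
      from : Remaining 0 (c , ℓ , c′) → edgesG k G (c , ℓ , c′)
      from (_ , w , eq , _ , ce , ce′) = w , at-map-proj₂⁺ L ℓ eq , ce , ce′

    Remaining-step : ∀ {p y} → lookup₁ V (suc p) ≡ just y →
                     Step G (Remaining p) (context k y) (L⁺.last y) (Remaining (suc p)) (context k (r y))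
    Remaining-step {p} {y} hy =
      ℓ₀ , (suc p , y , at₀ , ≤-refl , refl , refl) , minimal , removed ,
      y , at-map-proj₂⁺ L ℓ₀ at₀ , refl
      where
      ℓ₀ : ℕ
      ℓ₀ = proj₁ (∈⇒lookup₁ (lookup₁⇒∈L hy))
      at₀ : lookup₁ L ℓ₀ ≡ just (suc p , y)
      at₀ = proj₂ (∈⇒lookup₁ (lookup₁⇒∈L hy))

      minimal : ∀ j d → Remaining p (context k y , j , d) → ℓ₀ ≤ j
      minimal j d (q , w , atj , p<q , cy≡cw , _) = ≮⇒≥ λ j<ℓ₀ →
        <⇒≱ (≺-stable (AllPairs-lookup₁ L-sorted j<ℓ₀ atj at₀) (sym cy≡cw)) p<q

      ≢ℓ₀ : ∀ {ℓ q w} → lookup₁ L ℓ ≡ just (q , w) → suc p < q → ℓ ≢ ℓ₀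
      ≢ℓ₀ atℓ sp<q refl = <-irrefl (cong proj₁ (just-injective (trans (sym at₀) atℓ))) sp<q

      word≡y : ∀ ℓ {w} → lookup₁ L ℓ ≡ just (suc p , w) → w ≡ y
      word≡y ℓ eq = just-injective (trans (sym (∈L⇒lookup₁ (lookup₁⇒∈ ℓ eq))) hy)

      e₀ : Edge
      e₀ = context k y , ℓ₀ , context k (r y)

      removed : Remaining (suc p) ≐ (Remaining p ∖ e₀)
      removed (c , ℓ , c′) = to , from
        where
        to : Remaining (suc p) (c , ℓ , c′) → (Remaining p ∖ e₀) (c , ℓ , c′)
        to (q , w , atℓ , sp<q , ce , ce′) =
          (q , w , atℓ , <-trans (n<1+n p) sp<q , ce , ce′) , ≢ℓ₀ atℓ sp<q ∘ cong (proj₁ ∘ proj₂)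
        from : (Remaining p ∖ e₀) (c , ℓ , c′) → Remaining (suc p) (c , ℓ , c′)
        from ((q , w , atℓ , p<q , ce , ce′) , ne) with m≤n⇒m<n∨m≡n p<q
        ... | inj₁ sp<q = q , w , atℓ , sp<q , ce , ce′
        ... | inj₂ refl with word≡y ℓ atℓ
        ...   | refl =
          contradiction (cong₂ _,_ ce (cong₂ _,_ (lookup₁-injective ≺-irrefl L-sorted atℓ at₀) ce′)) ne

    Remaining-walk : ∀ p x → (∀ j → j < L⁺.length x → lookup₁ V (suc (j + p)) ≡ just (r^ j x)) →
                     Steps G (Remaining p) (context k x) (L⁺.toList x) (Remaining (L⁺.length x + p)) (context k x)
    Remaining-walk p x onV =
      subst (λ z → Steps G (Remaining p) (context k x) (L⁺.toList x) (Remaining (L⁺.length x + p)) (context k z))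
            (r^-length x) (walk [] (L⁺.toList x) refl onV)
      where
      walk : ∀ ys zs → L⁺.toList x ≡ ys ++ zs →
             (∀ j → j < length zs → lookup₁ V (suc (j + p)) ≡ just (r^ j x)) →
             Steps G (Remaining p) (context k x) zs (Remaining (length zs + p)) (context k (r^ (length zs) x))
      walk ys []       _  _   = ε
      walk ys (a ∷ zs) x≡ onV =
        step (walk (ys ∷ʳ a) zs (trans x≡ (sym (++-assoc ys [ a ] zs))) (λ j j< → onV j (m<n⇒m<1+n j<)))
             (subst (λ b → Step G (Remaining (length zs + p)) (context k y) b
                                  (Remaining (suc (length zs + p))) (context k (r y)))
                    (last-r^ x ys a zs x≡) (Remaining-step (onV (length zs) ≤-refl)))
        where
        y : Word
        y = r^ (length zs) x

  offset : ∀ {s} → Vec Word s → Fin (suc s) → ℕ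
  offset _        zero    = 0
  offset (w ∷ ws) (suc i) = L⁺.length w + offset ws i

  offset-suc : ∀ {s} (ws : Vec Word s) i → offset ws (suc i) ≡ L⁺.length (lookup ws i) + offset ws (inject₁ i)
  offset-suc (w ∷ ws) zero    = refl
  offset-suc (w ∷ ws) (suc i) =
    trans (cong (L⁺.length w +_) (offset-suc ws i))
          (x∙yz≈y∙xz (L⁺.length w) (L⁺.length (lookup ws i)) (offset ws (inject₁ i)))

  conjClass-applyUpTo : ∀ w → conjClass w ≡ applyUpTo (λ i → r^ i w) (L⁺.length w)
  conjClass-applyUpTo w = map-applyUpTo (λ i → i) (λ i → r^ i w) (L⁺.length w)

  lookup₁-conjClasses : ∀ {s} (ws : Vec Word s) i j → j < L⁺.length (lookup ws i) →
                        lookup₁ (concat (map conjClass (toList ws))) (suc (j + offset ws (inject₁ i)))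
                        ≡ just (r^ j (lookup ws i))
  lookup₁-conjClasses (w ∷ ws) zero j j< rewrite +-identityʳ j =
    trans (cong (λ cs → lookup₁ (cs ++ concat (map conjClass (toList ws))) (suc j)) (conjClass-applyUpTo w))
          (lookup₁-applyUpTo-++ (λ i → r^ i w) (L⁺.length w) _ j<)
  lookup₁-conjClasses (w ∷ ws) (suc i) j j< = begin
    entry (j + (L⁺.length w + o))          ≡⟨ cong entry (x∙yz≈y∙xz j (L⁺.length w) o) ⟩
    entry (L⁺.length w + (j + o))          ≡⟨ cong (λ n → entry (n + (j + o))) (sym length≡) ⟩
    entry (length (conjClass w) + (j + o)) ≡⟨ lookup₁-++ (conjClass w) rest (j + o) ⟩
    lookup₁ rest (suc (j + o))             ≡⟨ lookup₁-conjClasses ws i j j< ⟩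
    just (r^ j (lookup ws i))              ∎
    where
    rest : List Word
    rest = concat (map conjClass (toList ws))
    o : ℕ
    o = offset ws (inject₁ i)
    entry : ℕ → Maybe Word
    entry n = lookup₁ (conjClass w ++ rest) (suc n)
    length≡ : length (conjClass w) ≡ L⁺.length w
    length≡ = trans (cong length (conjClass-applyUpTo w)) (length-applyUpTo (λ i → r^ i w) (L⁺.length w))

lemma3 : {A : Set} {_<_ : Rel A 0ℓ} (sto : IsStrictTotalOrder _≡_ _<_) → FiniteNonEmpty A →
         let open Words sto in
         (k : ℕ) (s : ℕ) (v : Vec Word s) →
         let V = concat (map conjClass (toList v))
             G = M k V
         in Σ (Fin (suc s) → EdgeSet) λ C →
              (C zero ≡ edgesG k G)
              × (∀ (i : Fin s) →
                   Steps G (C (inject₁ i)) (context k (lookup v i)) (L⁺.toList (lookup v i))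
                           (C (suc i)) (context k (lookup v i)))
lemma3 sto _ k s v = C , refl , walk-class
  where
  open Words sto
  open WordsProperties sto
  open ContextGraph k (concat (map conjClass (toList v)))

  C : Fin (suc s) → EdgeSet
  C zero    = edgesG k G
  C (suc i) = Remaining (offset v (suc i))

  C≐Remaining : ∀ i → C (inject₁ i) ≐ Remaining (offset v (inject₁ i))
  C≐Remaining zero    = edgesG≐Remaining₀
  C≐Remaining (suc i) e = (λ m → m) , (λ m → m)

  walk-class : ∀ i → Steps G (C (inject₁ i)) (context k (lookup v i)) (L⁺.toList (lookup v i))
                             (C (suc i)) (context k (lookup v i))
  walk-class i =
    Steps-resp-≐ˡ (C≐Remaining i)
      (subst (λ p → Steps G (Remaining (offset v (inject₁ i))) (context k (lookup v i))
                           (L⁺.toList (lookup v i)) (Remaining p) (context k (lookup v i)))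
             (sym (offset-suc v i))
             (Remaining-walk (offset v (inject₁ i)) (lookup v i) (lookup₁-conjClasses v i)))
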